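{- Let $A$ be a residuated lattice and $F_M:=\{a\in A\mid \text{the set }\{M\in{\rm Max}(A)\mid a\notin M\}\text{ is finite}\}$. Then $F_M$ is a filter of $A$, and for every finite subset $\{M_1,\ldots,M_n\}$ of ${\rm Max}(A)$ we have $\bigcap\{M\mid M\in{\rm Max}(A)\setminus\{M_1,\ldots,M_n\}\}\subseteq F_M$.
   Context: A residuated lattice is a commutative integral residuated bounded lattice $(A,\vee,\wedge,\odot,\rightarrow,0,1)$ (bounded lattice, commutative monoid $(A,\odot,1)$, $a\le b\rightarrow c$ iff $a\odot b\le c$). A filter is a nonempty subset closed under $\odot$ and upward closed; ${\rm Max}(A)$ is the set of maximal filters (proper filters contained in no other proper filter). The intersection of the empty family is $A$. -}

module Defs where

open import Level using (Level; _⊔_; suc)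
open import Data.Product using (Σ; ∃; _×_; _,_)
open import Data.List using (List)
open import Data.List.Relation.Unary.All using (All)
open import Data.List.Relation.Unary.Any using (Any)
open import Relation.Nullary using (¬_)
open import Relation.Binary.PropositionalEquality using (_≡_)
open import Relation.Unary using (Pred; _∈_; _∉_; _⊆_; _≐_)
open import Algebra.Core using (Op₂)
open import Algebra.Structures using (IsCommutativeMonoid)
open import Algebra.Lattice.Structures using (IsLattice)

record ResiduatedLattice (c : Level) : Set (suc c) where
  infixr 6 _∨_
  infixr 7 _∧_
  infixl 8 _⊙_
  infixr 5 _⇒_
  infix 4 _≤_
  field
    Carrier : Set c
    _∨_ _∧_ _⊙_ _⇒_ : Op₂ Carrier
    0# 1# : Carrier
  _≤_ : Carrier → Carrier → Set c
  a ≤ b = a ∧ b ≡ a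
  field
    isLattice : IsLattice _≡_ _∨_ _∧_
    isCommutativeMonoid : IsCommutativeMonoid _≡_ _⊙_ 1#
    0-least : ∀ a → 0# ≤ a
    1-greatest : ∀ a → a ≤ 1#
    residuation-⇒ : ∀ a b d → a ≤ (b ⇒ d) → a ⊙ b ≤ d
    residuation-⇐ : ∀ a b d → a ⊙ b ≤ d → a ≤ (b ⇒ d)

module _ {c : Level} (A : ResiduatedLattice c) where
  open ResiduatedLattice A

  record IsFilter {ℓ : Level} (F : Pred Carrier ℓ) : Set (c ⊔ ℓ) where
    field
      nonempty : ∃ λ a → a ∈ F
      ⊙-closed : ∀ {a b} → a ∈ F → b ∈ F → (a ⊙ b) ∈ F
      up-closed : ∀ {a b} → a ≤ b → a ∈ F → b ∈ F

  IsProper : {ℓ : Level} → Pred Carrier ℓ → Set (c ⊔ ℓ)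
  IsProper F = ¬ (∀ a → a ∈ F)

  record IsMaximalFilter {ℓ : Level} (M : Pred Carrier ℓ) : Set (c ⊔ suc ℓ) where
    field
      isFilter : IsFilter M
      proper : IsProper M
      maximal : (G : Pred Carrier ℓ) → IsFilter G → IsProper G → M ⊆ G → G ⊆ M

  record MaxFilter (ℓ : Level) : Set (c ⊔ suc ℓ) where
    field
      set : Pred Carrier ℓ
      isMaximal : IsMaximalFilter set
  open MaxFilter public

  _≈M_ : {ℓ : Level} → MaxFilter ℓ → MaxFilter ℓ → Set (c ⊔ ℓ)
  M ≈M N = set M ≐ set N

  IsFiniteMax : {ℓ ℓ' : Level} → Pred (MaxFilter ℓ) ℓ' → Set (c ⊔ suc ℓ ⊔ ℓ')
  IsFiniteMax {ℓ} S = Σ (List (MaxFilter ℓ)) λ L →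
    All (λ N → N ∈ S) L × (∀ M → M ∈ S → Any (λ N → M ≈M N) L)

  F-Max : (ℓ : Level) → Pred Carrier (c ⊔ suc ℓ)
  F-Max ℓ a = IsFiniteMax {ℓ} (λ M → a ∉ set M)

  ⋂MaxExcept : {ℓ : Level} → List (MaxFilter ℓ) → Pred Carrier (c ⊔ suc ℓ)
  ⋂MaxExcept {ℓ} Ms a = (M : MaxFilter ℓ) → ¬ Any (λ N → M ≈M N) Ms → a ∈ set M

module Submission where

open import Defs
open import Level using (Level; _⊔_; suc; Lift; lift; lower)
open import Data.Empty using (⊥-elim)
open import Function using (case_of_)
open import Data.Product using (_×_; _,_; proj₂)
open import Data.Sum using (_⊎_; inj₁; inj₂)
open import Data.List using (List; []; _++_; filter)
open import Data.List.Relation.Unary.Any using (Any; any?)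
open import Data.List.Relation.Unary.Any.Properties as Any using (++⁺ˡ; ++⁺ʳ; lookup-result)
open import Data.List.Relation.Unary.All.Properties using (all-filter)
open import Relation.Nullary using (Dec; yes; no; ¬?)
open import Relation.Nullary.Decidable using (map′)
open import Relation.Unary using (Pred; Decidable; _∈_; _∉_; _⊆_)
open import Axiom.ExcludedMiddle using (ExcludedMiddle)

-- Under excluded middle a set of maximal filters is finite as soon as some
-- list covers it: filter the list down to the members of the set. Every
-- maximal filter contains 1, omits a ⊙ b only if it omits a or b, and omits b
-- only if it omits every a ≤ b; so the covering lists for {M | a ∉ M} can be
-- taken empty for a = 1, concatenated for a ⊙ b, and reused upwards. An element
-- of the intersection of all M outside Ms is covered by Ms itself.

module _ {c : Level} (A : ResiduatedLattice c) where
  open ResiduatedLattice A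

  1#∈filter : ∀ {ℓ} {F : Pred Carrier ℓ} → IsFilter A F → 1# ∈ F
  1#∈filter isF with IsFilter.nonempty isF
  ... | a , a∈F = IsFilter.up-closed isF (1-greatest a) a∈F

  ⊙∉filter⇒∉⊎∉ : ∀ {ℓ} {F : Pred Carrier ℓ} {a b} → IsFilter A F → Dec (a ∈ F) →
    a ⊙ b ∉ F → a ∉ F ⊎ b ∉ F
  ⊙∉filter⇒∉⊎∉ isF (yes a∈F) a⊙b∉F = inj₂ λ b∈F → a⊙b∉F (IsFilter.⊙-closed isF a∈F b∈F)
  ⊙∉filter⇒∉⊎∉ isF (no a∉F)  _     = inj₁ a∉F

  module _ {ℓ ℓ′ : Level} where

    Covers : List (MaxFilter A ℓ) → Pred (MaxFilter A ℓ) ℓ′ → Set (c ⊔ suc ℓ ⊔ ℓ′)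
    Covers L S = ∀ M → M ∈ S → Any (_≈M_ A M) L

    covered⇒finite : {S : Pred (MaxFilter A ℓ) ℓ′} →
      (∀ {M N} → _≈M_ A M N → M ∈ S → N ∈ S) → Decidable S →
      (L : List (MaxFilter A ℓ)) → Covers L S → IsFiniteMax A S
    covered⇒finite {S} S-resp S? L cover = filter S? L , all-filter S? L , cover′
      where
      cover′ : Covers (filter S? L) S
      cover′ M M∈S with Any.filter⁺ S? (cover M M∈S)
      ... | inj₁ M∈filtered = M∈filtered
      ... | inj₂ N∉S = ⊥-elim (N∉S (S-resp (lookup-result (cover M M∈S)) M∈S))

module _ {c ℓ : Level} (em : ExcludedMiddle (c ⊔ ℓ)) (A : ResiduatedLattice c) where
  open ResiduatedLattice A

  private
    decide : (P : Set ℓ) → Dec P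
    decide P = map′ lower lift (em {Lift c P})

    maxFilter : (M : MaxFilter A ℓ) → IsFilter A (set M)
    maxFilter M = IsMaximalFilter.isFilter (isMaximal M)

  covered⇒∈F-Max : ∀ {a} (L : List (MaxFilter A ℓ)) → Covers A L (λ M → a ∉ set M) →
    a ∈ F-Max A ℓ
  covered⇒∈F-Max {a} = covered⇒finite A (λ M≈N a∉M a∈N → a∉M (proj₂ M≈N a∈N))
    (λ M → ¬? (decide (a ∈ set M)))

  isFilter-F-Max : IsFilter A (F-Max A ℓ)
  isFilter-F-Max = record
    { nonempty  = 1# , covered⇒∈F-Max [] λ M 1#∉M → ⊥-elim (1#∉M (1#∈filter A (maxFilter M)))
    ; ⊙-closed  = λ (La , _ , coverA) (Lb , _ , coverB) → covered⇒∈F-Max (La ++ Lb) λ M a⊙b∉M →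
        case ⊙∉filter⇒∉⊎∉ A (maxFilter M) (decide _) a⊙b∉M of λ where
          (inj₁ a∉M) → ++⁺ˡ (coverA M a∉M)
          (inj₂ b∉M) → ++⁺ʳ La (coverB M b∉M)
    ; up-closed = λ a≤b (L , _ , cover) → covered⇒∈F-Max L λ M b∉M →
        cover M λ a∈M → b∉M (IsFilter.up-closed (maxFilter M) a≤b a∈M)
    }

  ⋂MaxExcept⊆F-Max : (Ms : List (MaxFilter A ℓ)) → ⋂MaxExcept A Ms ⊆ F-Max A ℓ
  ⋂MaxExcept⊆F-Max Ms a∈⋂ = covered⇒∈F-Max Ms λ M a∉M →
    case any? (λ _ → em) Ms of λ where
      (yes M∈Ms) → M∈Ms
      (no M∉Ms)  → ⊥-elim (a∉M (a∈⋂ M M∉Ms))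

lemma2p5 : {c ℓ : Level} → ExcludedMiddle (c ⊔ ℓ) → (A : ResiduatedLattice c) →
    IsFilter A (F-Max A ℓ) ×
    ((Ms : List (MaxFilter A ℓ)) → ⋂MaxExcept A Ms ⊆ F-Max A ℓ)
lemma2p5 em A = isFilter-F-Max em A , ⋂MaxExcept⊆F-Max em A
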